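{- Let $G$ be a $2$-connected graph. Then $vcfc(G)=2$.
   Context: Vertex-colorings are arbitrary, not necessarily proper. A path in a vertex-colored graph is called conflict-free if there is a color used on exactly one of its vertices. A vertex-colored graph is conflict-free vertex-connected if any two vertices of the graph are connected by a conflict-free path. For a connected graph $G$, the conflict-free vertex-connection number $vcfc(G)$ is the smallest number of colors needed in a vertex-coloring of $G$ that makes $G$ conflict-free vertex-connected. -}

module Defs where

open import Data.Nat using (ℕ; _≤_; _≥_)
open import Data.Fin using (Fin)
open import Data.Fin.Properties using (_≟_)
open import Data.List using (List; head; last; filter; length)
open import Data.List.Membership.Propositional using (_∉_)
open import Data.List.Relation.Unary.Linked using (Linked)
open import Data.List.Relation.Unary.Unique.Propositional using (Unique)
open import Data.Maybe using (just)
open import Data.Product using (_×_; Σ; ∃; ∃-syntax)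
open import Relation.Binary.PropositionalEquality using (_≡_)
open import Relation.Nullary using (¬_)

record Graph (n : ℕ) : Set₁ where
  field
    Adj    : Fin n → Fin n → Set
    sym    : ∀ {u v} → Adj u v → Adj v u
    irrefl : ∀ {v} → ¬ Adj v v
open Graph public

IsPath : ∀ {n} → Graph n → Fin n → Fin n → List (Fin n) → Set
IsPath G u v p = head p ≡ just u × last p ≡ just v × Unique p × Linked (Adj G) p

Connected : ∀ {n} → Graph n → Set
Connected {n} G = ∀ (u v : Fin n) → ∃[ p ] IsPath G u v p

ConnectedWithout : ∀ {n} → Graph n → Fin n → Set
ConnectedWithout {n} G w =
  ∀ (u v : Fin n) → ¬ u ≡ w → ¬ v ≡ w → ∃[ p ] (IsPath G u v p × w ∉ p)

TwoConnected : ∀ {n} → Graph n → Set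
TwoConnected {n} G = 3 ≤ n × Connected G × (∀ (w : Fin n) → ConnectedWithout G w)

count : ∀ {n k} → (Fin n → Fin k) → Fin k → List (Fin n) → ℕ
count c i p = length (filter (λ x → c x ≟ i) p)

ConflictFree : ∀ {n k} → (Fin n → Fin k) → List (Fin n) → Set
ConflictFree {k = k} c p = ∃[ i ] count c i p ≡ 1

CFVConnected : ∀ {n k} → Graph n → (Fin n → Fin k) → Set
CFVConnected {n} G c = ∀ (u v : Fin n) → ∃[ p ] (IsPath G u v p × ConflictFree c p)

VcfcIs : ∀ {n} → Graph n → ℕ → Set
VcfcIs {n} G m =
  (Σ (Fin n → Fin m) λ c → CFVConnected G c) ×
  (∀ (k : ℕ) (c : Fin n → Fin k) → CFVConnected G c → m ≤ k)

-- Colour one vertex w with 1 and all others with 0: a path through w then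
-- carries colour 1 exactly once, so it suffices to join any two distinct
-- vertices u, v by a path through w. By Whitney's theorem, proved along a
-- path by rerouting around the previous endpoint with a detour that avoids
-- it, there are two internally disjoint w–u paths. A w–v path avoiding u
-- leaves them for the last time at some x; going from u to w along one of
-- them, on to x along the other and then to v gives the required path.
-- One colour never suffices: it occurs at least twice on any path between
-- distinct vertices.
module Submission where

open import Defs
open import Data.Nat using (ℕ; zero; suc; _≤_; s≤s; z≤n)
open import Data.Fin using (Fin; zero; suc)
open import Data.Fin.Properties using (_≟_)
open import Data.List using (List; []; _∷_; _++_; filter; length)
open import Data.List.Properties using (filter-accept; filter-all)
open import Data.List.Membership.Propositional using (_∈_; _∉_)
open import Data.List.Membership.Propositional.Properties using (∈-++⁻)
import Data.List.Membership.DecPropositional as DecMembership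
open import Data.List.Relation.Binary.Subset.Propositional using (_⊆_)
open import Data.List.Relation.Binary.Subset.Propositional.Properties using (∷⁺ʳ; ∈-∷⁺ʳ)
open import Data.List.Relation.Unary.All using ([])
import Data.List.Relation.Unary.All as All
open import Data.List.Relation.Unary.All.Properties using (¬Any⇒All¬; All¬⇒¬Any)
open import Data.List.Relation.Unary.AllPairs using ([]; _∷_)
open import Data.List.Relation.Unary.Any using (here; there)
open import Data.List.Relation.Unary.Linked using ([]; [-]; _∷_)
open import Data.List.Relation.Unary.Unique.Propositional using (Unique)
open import Data.Product using (∃-syntax; _×_; _,_)
open import Data.Sum using (_⊎_; inj₁; inj₂)
import Data.Sum as Sum
open import Data.Empty using (⊥-elim)
open import Function using (_∘_; id)
open import Relation.Nullary using (¬_; Dec; yes; no)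
open import Relation.Nullary.Decidable using (_⊎-dec_)
open import Relation.Binary.PropositionalEquality using (_≡_; refl; cong; subst)
import Relation.Binary.PropositionalEquality as ≡

module Paths {n : ℕ} (G : Graph n) where

  open DecMembership (_≟_ {n}) using (_∈?_)

  Vertex : Set
  Vertex = Fin n

  data Path : Vertex → Vertex → List Vertex → Set where
    [_]  : ∀ x → Path x x (x ∷ [])
    cons : ∀ {x y v p} → Adj G x y → x ∉ p → Path y v p → Path x v (x ∷ p)

  start∈ : ∀ {u v p} → Path u v p → u ∈ p
  start∈ [ x ]        = here refl
  start∈ (cons _ _ _) = here refl

  end∈ : ∀ {u v p} → Path u v p → v ∈ p
  end∈ [ x ]           = here refl
  end∈ (cons _ _ rest) = there (end∈ rest)

  IsPath-cons : ∀ {x y v p} → Adj G x y → x ∉ p → IsPath G y v p → IsPath G x v (x ∷ p)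
  IsPath-cons {p = []}    _   _   (() , _)
  IsPath-cons {p = _ ∷ _} adj x∉p (refl , last≡v , unique , linked) =
    refl , last≡v , ¬Any⇒All¬ _ x∉p ∷ unique , adj ∷ linked

  Path⇒IsPath : ∀ {u v p} → Path u v p → IsPath G u v p
  Path⇒IsPath [ x ]              = refl , refl , [] ∷ [] , [-]
  Path⇒IsPath (cons adj x∉p rest) = IsPath-cons adj x∉p (Path⇒IsPath rest)

  IsPath⇒Path : ∀ {u v} p → IsPath G u v p → Path u v p
  IsPath⇒Path []          (() , _)
  IsPath⇒Path (x ∷ [])    (refl , refl , _ , _) = [ x ]
  IsPath⇒Path (x ∷ y ∷ p) (refl , last≡v , x∉ ∷ unique , adj ∷ linked) =
    cons adj (All¬⇒¬Any x∉) (IsPath⇒Path (y ∷ p) (refl , last≡v , unique , linked))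

  connectingPath : Connected G → ∀ u v → ∃[ p ] Path u v p
  connectingPath connected u v with connected u v
  ... | p , isPath = p , IsPath⇒Path p isPath

  edge : ∀ {x y} → Adj G x y → Path x y (x ∷ y ∷ [])
  edge {x} adj = cons adj x∉[y] [ _ ]
    where
      x∉[y] : x ∉ _ ∷ []
      x∉[y] (here refl) = irrefl G adj

  MeetOnlyAt : Vertex → List Vertex → List Vertex → Set
  MeetOnlyAt x p q = ∀ {y} → y ∈ p → y ∈ q → y ≡ x

  concat : ∀ {u x v p q} → Path u x p → Path x v q → MeetOnlyAt x p q →
           ∃[ r ] (Path u v r × r ⊆ p ++ q × p ⊆ r)
  concat [ x ] Q _ = _ , Q , there , ∈-∷⁺ʳ (start∈ Q) (λ ())
  concat {q = q} (cons {x = a} {p = p} adj a∉p P) Q meet with concat P Q (meet ∘ there)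
  ... | r , R , r⊆p++q , p⊆r = _ , cons adj a∉r R , ∷⁺ʳ a r⊆p++q , ∷⁺ʳ a p⊆r
    where
      a∉r : a ∉ r
      a∉r a∈r with ∈-++⁻ p (r⊆p++q a∈r)
      ... | inj₁ a∈p = a∉p a∈p
      ... | inj₂ a∈q = a∉p (subst (_∈ p) (≡.sym (meet (here refl) a∈q)) (end∈ P))

  reverse : ∀ {u v p} → Path u v p → ∃[ r ] (Path v u r × r ⊆ p)
  reverse [ x ] = _ , [ x ] , id
  reverse (cons {x = a} {y = y} {p = p} adj a∉p P) with reverse P
  ... | r , R , r⊆p with concat R (edge (sym G adj)) meet
    where
      meet : MeetOnlyAt y r (y ∷ a ∷ [])
      meet _ (here refl) = refl
      meet a∈r (there (here refl)) = ⊥-elim (a∉p (r⊆p a∈r))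
  ... | s , S , s⊆r++ya , _ = s , S , s⊆a∷p
    where
      s⊆a∷p : s ⊆ a ∷ p
      s⊆a∷p z∈s with ∈-++⁻ r (s⊆r++ya z∈s)
      ... | inj₁ z∈r                 = there (r⊆p z∈r)
      ... | inj₂ (here refl)         = there (start∈ P)
      ... | inj₂ (there (here refl)) = here refl

  prefix : ∀ {u v p x} → Path u v p → x ∈ p →
           ∃[ q ] (Path u x q × q ⊆ p × (v ∈ q → v ≡ x))
  prefix [ x ] (here refl) = _ , [ x ] , id , λ _ → refl
  prefix (cons _ _ _) (here refl) =
    _ , [ _ ] , ∈-∷⁺ʳ (here refl) (λ ()) , λ { (here v≡x) → v≡x }
  prefix {v = v} {x = x} (cons {x = a} adj a∉p P) (there x∈p) with prefix P x∈p
  ... | q , Q , q⊆p , atEnd = _ , cons adj (a∉p ∘ q⊆p) Q , ∷⁺ʳ a q⊆p , ends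
    where
      ends : v ∈ a ∷ q → v ≡ x
      ends (here refl) = ⊥-elim (a∉p (end∈ P))
      ends (there v∈q) = atEnd v∈q

  record FirstHit (S : Vertex → Set) (u : Vertex) (p : List Vertex) : Set where
    field
      {target}  : Vertex
      {visited} : List Vertex
      inS       : S target
      path      : Path u target visited
      visited⊆p : visited ⊆ p
      onlyEnd   : ∀ {y} → y ∈ visited → S y → y ≡ target

  firstHit : ∀ {S : Vertex → Set} {u v p} → (∀ y → Dec (S y)) → S v → Path u v p → FirstHit S u p
  firstHit S? Sv [ x ] = record
    { inS = Sv ; path = [ x ] ; visited⊆p = id ; onlyEnd = λ { (here y≡x) _ → y≡x } }
  firstHit S? Sv (cons {x = a} adj a∉p P) with S? a
  ... | yes Sa = record
    { inS = Sa ; path = [ a ] ; visited⊆p = ∈-∷⁺ʳ (here refl) (λ ())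
    ; onlyEnd = λ { (here y≡a) _ → y≡a } }
  ... | no ¬Sa = record
    { inS = inS ; path = cons adj (a∉p ∘ visited⊆p) path
    ; visited⊆p = ∷⁺ʳ a visited⊆p ; onlyEnd = λ { (here refl) Sa → ⊥-elim (¬Sa Sa) ; (there y∈) → onlyEnd y∈ } }
    where open FirstHit (firstHit S? Sv P)

  record LastHit (S : Vertex → Set) (v : Vertex) (p : List Vertex) : Set where
    field
      {source}  : Vertex
      {visited} : List Vertex
      inS       : S source
      path      : Path source v visited
      visited⊆p : visited ⊆ p
      onlyStart : ∀ {y} → y ∈ visited → S y → y ≡ source

  lastHit : ∀ {S : Vertex → Set} {u v p} → (∀ y → Dec (S y)) → S u → Path u v p → LastHit S v p
  lastHit S? Su P with reverse P
  ... | r , R , r⊆p with firstHit S? Su R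
  ... | hit with reverse (FirstHit.path hit)
  ... | q , Q , q⊆ = record
    { inS = FirstHit.inS hit ; path = Q ; visited⊆p = r⊆p ∘ FirstHit.visited⊆p hit ∘ q⊆
    ; onlyStart = FirstHit.onlyEnd hit ∘ q⊆ }

  record DisjointPaths (a b : Vertex) : Set where
    field
      {left right} : List Vertex
      leftPath     : Path a b left
      rightPath    : Path a b right
      disjoint     : ∀ {y} → y ∈ left → y ∈ right → y ≡ a ⊎ y ≡ b

    OnPaths : Vertex → Set
    OnPaths y = y ∈ left ⊎ y ∈ right

    onPaths? : ∀ y → Dec (OnPaths y)
    onPaths? y = (y ∈? left) ⊎-dec (y ∈? right)

  open DisjointPaths

  swap : ∀ {a b} → DisjointPaths a b → DisjointPaths a b
  swap C = record
    { leftPath = rightPath C ; rightPath = leftPath C ; disjoint = λ l r → disjoint C r l }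

  edgePaths : ∀ {a b} → Adj G a b → DisjointPaths a b
  edgePaths {a} {b} adj = record { leftPath = edge adj ; rightPath = edge adj ; disjoint = λ y∈ _ → ends y∈ }
    where
      ends : ∀ {y} → y ∈ a ∷ b ∷ [] → y ≡ a ⊎ y ≡ b
      ends (here y≡a)         = inj₁ y≡a
      ends (there (here y≡b)) = inj₂ y≡b

  -- The part of p after its last vertex on the two paths, which may be
  -- renamed so that this vertex lies on the left one.
  record Exit (a b v : Vertex) (p : List Vertex) : Set where
    field
      paths     : DisjointPaths a b
      {exit}    : Vertex
      {tail}    : List Vertex
      exit∈left : exit ∈ left paths
      tailPath  : Path exit v tail
      tail⊆p    : tail ⊆ p
      offPaths  : ∀ {z} → z ∈ tail → OnPaths paths z → z ≡ exit

  lastExit : ∀ {a b v p} → DisjointPaths a b → Path a v p → Exit a b v p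
  lastExit C P with lastHit (onPaths? C) (inj₁ (start∈ (leftPath C))) P
  ... | record { inS = inj₁ x∈left ; path = T ; visited⊆p = t⊆p ; onlyStart = only } =
    record { paths = C ; exit∈left = x∈left ; tailPath = T ; tail⊆p = t⊆p ; offPaths = only }
  ... | record { inS = inj₂ x∈right ; path = T ; visited⊆p = t⊆p ; onlyStart = only } =
    record { paths = swap C ; exit∈left = x∈right ; tailPath = T ; tail⊆p = t⊆p
           ; offPaths = λ z∈t → only z∈t ∘ Sum.swap }

  -- The left path up to the exit followed by the tail, and the right path
  -- followed by the edge y–b.
  reroute : ∀ {a y b p} → Exit a y b p → Adj G y b → ¬ b ≡ a → y ∉ p → DisjointPaths a b
  reroute {a} {y} {b}
          record { paths = C ; exit = x ; tail = t ; exit∈left = x∈left ; tailPath = T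
                 ; tail⊆p = t⊆p ; offPaths = onlyAtX }
          adj b≢a y∉p
    with prefix (leftPath C) x∈left
  ... | pA , A , pA⊆left , y∈pA⇒y≡x
    with concat A T (λ z∈pA z∈t → onlyAtX z∈t (inj₁ (pA⊆left z∈pA)))
       | concat (rightPath C) (edge adj) meetEdge
    where
      -- b lies on the tail, so on the right path it would be the exit,
      -- hence on both paths.
      b∉right : b ∉ right C
      b∉right b∈right with disjoint C (subst (_∈ left C) (≡.sym (onlyAtX (end∈ T) (inj₂ b∈right))) x∈left) b∈right
      ... | inj₁ b≡a = b≢a b≡a
      ... | inj₂ refl = irrefl G adj

      meetEdge : MeetOnlyAt y (right C) (y ∷ b ∷ [])
      meetEdge _       (here z≡y)         = z≡y
      meetEdge b∈right (there (here refl)) = ⊥-elim (b∉right b∈right)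
  ... | l , L , l⊆pA++t , _ | r , R , r⊆right++yb , _ =
    record { leftPath = L ; rightPath = R ; disjoint = disjoint′ }
    where
      y∉t : y ∉ t
      y∉t = y∉p ∘ t⊆p

      y∉pA : y ∉ pA
      y∉pA y∈pA = y∉t (subst (_∈ t) (≡.sym (y∈pA⇒y≡x y∈pA)) (start∈ T))

      disjoint′ : ∀ {z} → z ∈ l → z ∈ r → z ≡ a ⊎ z ≡ b
      disjoint′ z∈l z∈r with ∈-++⁻ pA (l⊆pA++t z∈l) | ∈-++⁻ (right C) (r⊆right++yb z∈r)
      ... | inj₁ z∈pA | inj₁ z∈right with disjoint C (pA⊆left z∈pA) z∈right
      ...   | inj₁ z≡a  = inj₁ z≡a
      ...   | inj₂ refl = ⊥-elim (y∉pA z∈pA)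
      disjoint′ _ _ | inj₁ z∈pA | inj₂ (here refl)         = ⊥-elim (y∉pA z∈pA)
      disjoint′ _ _ | _         | inj₂ (there (here z≡b)) = inj₂ z≡b
      disjoint′ _ _ | inj₂ z∈t  | inj₁ z∈right with onlyAtX z∈t (inj₂ z∈right)
      ... | refl with disjoint C x∈left z∈right
      ...   | inj₁ x≡a  = inj₁ x≡a
      ...   | inj₂ refl = ⊥-elim (y∉t z∈t)
      disjoint′ _ _ | inj₂ z∈t  | inj₂ (here refl)         = ⊥-elim (y∉t z∈t)

  pathVia : ∀ {w u v p} → Exit w u v p → u ∉ p → ∃[ q ] (Path u v q × w ∈ q)
  pathVia {w} {u}
          record { paths = C ; exit = x ; tail = t ; exit∈left = x∈left ; tailPath = T
                 ; tail⊆p = t⊆p ; offPaths = onlyAtX }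
          u∉p
    with prefix (leftPath C) x∈left | reverse (rightPath C)
  ... | pA , A , pA⊆left , u∈pA⇒u≡x | r , R , r⊆right
    with concat R A meet
    where
      meet : MeetOnlyAt w r pA
      meet z∈r z∈pA with disjoint C (pA⊆left z∈pA) (r⊆right z∈r)
      ... | inj₁ z≡w  = z≡w
      ... | inj₂ refl = ⊥-elim (u∉p (t⊆p (subst (_∈ t) (≡.sym (u∈pA⇒u≡x z∈pA)) (start∈ T))))
  ... | s , S , s⊆r++pA , r⊆s with concat S T meetT
    where
      meetT : MeetOnlyAt x s t
      meetT z∈s z∈t with ∈-++⁻ r (s⊆r++pA z∈s)
      ... | inj₁ z∈r  = onlyAtX z∈t (inj₂ (r⊆right z∈r))
      ... | inj₂ z∈pA = onlyAtX z∈t (inj₁ (pA⊆left z∈pA))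
  ... | f , F , _ , s⊆f = f , F , s⊆f (r⊆s (end∈ R))

module NoCutVertex {n : ℕ} {G : Graph n} (noCut : ∀ w → ConnectedWithout G w) where
  open Paths G

  private
    ≢-adj : ∀ {x y} → Adj G x y → ¬ x ≡ y
    ≢-adj adj refl = irrefl G adj

  extend : ∀ {a y b} → DisjointPaths a y → Adj G y b → ¬ b ≡ a → ¬ a ≡ y → DisjointPaths a b
  extend {a} {y} {b} C adj b≢a a≢y with noCut y a b a≢y (≢-adj (sym G adj))
  ... | p , isPath , y∉p = reroute (lastExit C (IsPath⇒Path p isPath)) adj b≢a y∉p

  whitney : ∀ {a b p} → Path b a p → ¬ b ≡ a → DisjointPaths a b
  whitney [ x ] b≢a = ⊥-elim (b≢a refl)
  whitney {a} (cons {y = y} adj _ rest) b≢a with y ≟ a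
  ... | yes refl = edgePaths (sym G adj)
  ... | no y≢a   = extend (whitney rest y≢a) (sym G adj) b≢a (y≢a ∘ ≡.sym)

  pathThrough : Connected G → ∀ w {u v} → ¬ u ≡ v → ∃[ p ] (Path u v p × w ∈ p)
  pathThrough connected w {u} {v} u≢v with w ≟ u | w ≟ v | connectingPath connected u v
  ... | yes refl | _        | p , P = p , P , start∈ P
  ... | no _     | yes refl | p , P = p , P , end∈ P
  ... | no w≢u   | no _     | _ with connectingPath connected u w | noCut u w v w≢u (u≢v ∘ ≡.sym)
  ... | _ , P | p , isPath , u∉p =
    pathVia (lastExit (whitney P (w≢u ∘ ≡.sym)) (IsPath⇒Path p isPath)) u∉p

mark : ∀ {m} → Fin (suc m) → Fin 2
mark zero    = suc zero
mark (suc _) = zero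

count-mark-∉ : ∀ {m} {p : List (Fin (suc m))} → zero ∉ p → count mark (suc zero) p ≡ 0
count-mark-∉ {p = []}        _   = refl
count-mark-∉ {p = zero ∷ p}  0∉p = ⊥-elim (0∉p (here refl))
count-mark-∉ {p = suc _ ∷ p} 0∉p = count-mark-∉ (0∉p ∘ there)

count-mark-∈ : ∀ {m} {p : List (Fin (suc m))} → Unique p → zero ∈ p → count mark (suc zero) p ≡ 1
count-mark-∈ {p = zero ∷ p}  (0∉p ∷ _)   _                = cong suc (count-mark-∉ (All¬⇒¬Any 0∉p))
count-mark-∈ {p = suc _ ∷ p} (_ ∷ unique) (there 0∈p) = count-mark-∈ unique 0∈p

singleton-conflictFree : ∀ {n k} (c : Fin n → Fin k) u → ConflictFree c (u ∷ [])
singleton-conflictFree c u = c u , cong length (filter-accept (λ x → c x ≟ c u) refl)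

mark-CFVConnected : ∀ {m} (G : Graph (suc m)) → Connected G → (∀ w → ConnectedWithout G w) →
                    CFVConnected G mark
mark-CFVConnected G connected noCut u v with u ≟ v
... | yes refl = u ∷ [] , Path⇒IsPath [ u ] , singleton-conflictFree mark u
  where open Paths G
... | no u≢v with NoCutVertex.pathThrough noCut connected zero u≢v
... | p , P , 0∈p with Paths.Path⇒IsPath G P
... | isPath@(_ , _ , unique , _) = p , isPath , suc zero , count-mark-∈ unique 0∈p

count-monochrome : ∀ {n} (c : Fin n → Fin 1) p → count c zero p ≡ length p
count-monochrome c p = cong length (filter-all (λ x → c x ≟ zero) {p} (All.tabulate (λ {x} _ → only-zero (c x))))
  where
    only-zero : (i : Fin 1) → i ≡ zero
    only-zero zero = refl

distinctEnds⇒2≤length : ∀ {n} {G : Graph n} {u v} p → IsPath G u v p → ¬ u ≡ v → 2 ≤ length p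
distinctEnds⇒2≤length []          (() , _)           _
distinctEnds⇒2≤length (_ ∷ [])    (refl , refl , _) u≢u = ⊥-elim (u≢u refl)
distinctEnds⇒2≤length (_ ∷ _ ∷ _) _                 _   = s≤s (s≤s z≤n)

CFVConnected⇒2≤colours : ∀ {m k} (G : Graph (suc (suc m))) (c : Fin (suc (suc m)) → Fin k) →
                         CFVConnected G c → 2 ≤ k
CFVConnected⇒2≤colours {k = zero} G c _ with c zero
... | ()
CFVConnected⇒2≤colours {k = suc zero} G c connected with connected zero (suc zero)
... | p , isPath , zero , once = subst (2 ≤_) length≡1 (distinctEnds⇒2≤length {G = G} p isPath λ ())
  where
    length≡1 : length p ≡ 1
    length≡1 = ≡.trans (≡.sym (count-monochrome c p)) once
CFVConnected⇒2≤colours {k = suc (suc _)} G c _ = s≤s (s≤s z≤n)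

lemma2 : ∀ (n : ℕ) (G : Graph n) → TwoConnected G → VcfcIs G 2
lemma2 (suc (suc m)) G (_ , connected , noCut) =
  (mark , mark-CFVConnected G connected noCut) , λ _ c → CFVConnected⇒2≤colours G c
lemma2 zero       G (() , _)
lemma2 (suc zero) G (s≤s () , _)
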